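{- Fix $\ell\in\mathbb Z$. For a vertex $(X,Y,Z)$ of $\mathrm{MM}\mathbb T(2,\ell)$, let $n_X/d_X$, $n_Y/d_Y$, $n_Z/d_Z$ be the reduced expressions of the absolute values of the fixed points of $X,Y,Z$ respectively (acting as Möbius transformations on $\mathbb RP^1$; $\infty$ has reduced expression $1/0$). Then $(n_X,n_Y,n_Z)$ is a Markov triple, and the map $(X,Y,Z)\mapsto(n_X,n_Y,n_Z)$ is a canonical graph isomorphism from $\mathrm{MM}\mathbb T(2,\ell)$ to $\mathrm{M}\mathbb T(0)$.
   Context: A Markov triple is $(a,b,c)\in\mathbb Z_{\ge1}^3$ with $a^2+b^2+c^2=3abc$. $\mathrm{MM}\mathbb T(2,\ell)$ is the infinite rooted binary tree with root $(X_\ell,Y_\ell,Z_\ell)$, \[X_\ell=\begin{bmatrix}\ell&1\\-(\ell+1)^2&-\ell-2\end{bmatrix},\quad Y_\ell=\begin{bmatrix}4\ell-3&4\\-(2\ell-1)^2&-4\ell+1\end{bmatrix},\quad Z_\ell=\begin{bmatrix}\ell-3&1\\-(\ell-2)^2&-\ell+1\end{bmatrix},\] in which each vertex $(X,Y,Z)$ has left child $(X,YZY^{ -1},Y)$ and right child $(Y,Y^{ -1}XY,Z)$. Every matrix occurring has trace $-2$ and positive $(1,2)$-entry, so as a Möbius transformation $z\mapsto (az+b)/(cz+d)$ of $\mathbb RP^1=\mathbb R\cup\{\infty\}$ it has a unique fixed point, which lies in $\mathbb Q\cup\{\infty\}$. For $q\in\mathbb Q_{\ge0}\cup\{\infty\}$,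 the reduced expression of $q$ is $n/d$ with $n,d\in\mathbb Z_{\ge0}$ relatively prime and $q=n/d$ (with $n/0=\infty$ for $n>0$). $\mathrm{M}\mathbb T(0)$ is the rooted binary tree with root $(1,2,1)$ in which each vertex $(a,b,c)$ has left child $(a,(a^2+b^2)/c,b)$ and right child $(b,(b^2+c^2)/a,c)$. A canonical graph isomorphism between rooted full binary trees is a bijection of vertex sets sending the root to the root and the left (resp. right) child of every vertex to the left (resp. right) child of its image. -}

module Defs where

open import Data.Nat as ℕ using (ℕ; zero; suc)
open import Data.Nat.DivMod using (_/_)
open import Data.Nat.Coprimality using (Coprime)
open import Data.Integer as ℤ using (ℤ; +_; -_; _+_; _*_; _-_; ∣_∣)
open import Data.List using (List; []; _∷_)
open import Data.Product using (_×_; _,_; Σ; ∃)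
open import Relation.Binary.PropositionalEquality using (_≡_)

record Mat : Set where
  constructor mat
  field
    a b c d : ℤ
open Mat public

_⊗_ : Mat → Mat → Mat
mat a₁ b₁ c₁ d₁ ⊗ mat a₂ b₂ c₂ d₂ =
  mat (a₁ * a₂ + b₁ * c₂) (a₁ * b₂ + b₁ * d₂)
      (c₁ * a₂ + d₁ * c₂) (c₁ * b₂ + d₁ * d₂)

-- Inverse of a determinant-1 matrix (all matrices in MMT(2,ℓ) lie in SL₂(ℤ):
-- the three root matrices have determinant 1 and the tree operations are
-- products/conjugations), namely the adjugate.
inv : Mat → Mat
inv (mat a b c d) = mat d (- b) (- c) a

det : Mat → ℤ
det (mat a b c d) = a * d - b * c

Xℓ Yℓ Zℓ : ℤ → Mat
Xℓ l = mat l (+ 1) (- ((l + + 1) * (l + + 1))) (- l - + 2)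
Yℓ l = mat (+ 4 * l - + 3) (+ 4)
           (- ((+ 2 * l - + 1) * (+ 2 * l - + 1))) (- (+ 4 * l) + + 1)
Zℓ l = mat (l - + 3) (+ 1) (- ((l - + 2) * (l - + 2))) (- l + + 1)

-- Directions in a rooted binary tree; a vertex is addressed by the list of
-- directions taken from the root (first step = head of the list is the
-- LAST step taken, i.e. the path (d ∷ p) is the d-child of the vertex at p).
data Dir : Set where
  L R : Dir

Path : Set
Path = List Dir

MTriple : Set
MTriple = Mat × Mat × Mat

stepMM : Dir → MTriple → MTriple
stepMM L (X , Y , Z) = (X , (Y ⊗ Z) ⊗ inv Y , Y)
stepMM R (X , Y , Z) = (Y , (inv Y ⊗ X) ⊗ Y , Z)

MMT : ℤ → Path → MTriple
MMT l []      = (Xℓ l , Yℓ l , Zℓ l)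
MMT l (d ∷ p) = stepMM d (MMT l p)

-- ℕ-division with the (never used) convention m ÷ 0 = 0
_÷_ : ℕ → ℕ → ℕ
m ÷ zero  = 0
m ÷ suc k = m / suc k

NTriple : Set
NTriple = ℕ × ℕ × ℕ

stepM : Dir → NTriple → NTriple
stepM L (x , y , z) = (x , (x ℕ.* x ℕ.+ y ℕ.* y) ÷ z , y)
stepM R (x , y , z) = (y , (y ℕ.* y ℕ.+ z ℕ.* z) ÷ x , z)

MT0 : Path → NTriple
MT0 []      = (1 , 2 , 1)
MT0 (d ∷ p) = stepM d (MT0 p)

IsMarkov : NTriple → Set
IsMarkov (x , y , z) =
  1 ℕ.≤ x × 1 ℕ.≤ y × 1 ℕ.≤ z ×
  x ℕ.* x ℕ.+ y ℕ.* y ℕ.+ z ℕ.* z ≡ 3 ℕ.* x ℕ.* y ℕ.* z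

-- The point [u : v] of ℝP¹ (u/v, with v = 0 meaning ∞) is fixed by the
-- Möbius transformation of M: M (u,v)ᵀ is proportional to (u,v)ᵀ.
FixedBy : Mat → ℤ → ℤ → Set
FixedBy (mat a b c d) u v = v * (a * u + b * v) ≡ u * (c * u + d * v)

-- (u , v) is a reduced (primitive) representative of a fixed point of M;
-- then ∣u∣ / ∣v∣ is the reduced expression of the absolute value of it.
PrimFixed : Mat → ℤ → ℤ → Set
PrimFixed M u v = Coprime ∣ u ∣ ∣ v ∣ × FixedBy M u v

-- "n is the numerator of the reduced expression of |fixed point of M|":
-- a fixed point exists, and every primitive representative has |u| = n.
FixNum : Mat → ℕ → Set
FixNum M n = (∃ λ u → ∃ λ v → PrimFixed M u v)
           × (∀ u v → PrimFixed M u v → ∣ u ∣ ≡ n)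

FixNums : MTriple → NTriple → Set
FixNums (X , Y , Z) (x , y , z) = FixNum X x × FixNum Y y × FixNum Z z

{-# OPTIONS --safe #-}
module Submission where

-- Every matrix of MMT(2,ℓ) is a parabolic P(w) = −I + w (Jw)ᵀ for a primitive w = (p , q),
-- whose only fixed point is p/q, so the numerator in question is ∣p∣. For M ∈ SL₂(ℤ) one has
-- M P(w) M⁻¹ = P(M w), and P(b) c = ω(b,c) b − c with ω the determinant pairing, so the tree
-- acts on the fixed vectors (a , b , c) by (a , ω(b,c) b − c , b) and (b , ω(a,b) b − a , c).
-- If a, b, c have first coordinates x, y, z and ω(a,b) = 3z, ω(b,c) = 3x, ω(a,c) = 3(3xz − y),
-- then the new middle coordinate is 3xy − z = (x² + y²)/z (resp. 3yz − x), the Vieta move of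
-- the Markov tree, and the three pairings reproduce themselves.

open import Defs
open import Data.Integer using (ℤ; +_; -_; _+_; _*_; _-_; ∣_∣; 0ℤ)
import Data.Integer.Properties as ℤₚ
import Data.Integer.Divisibility.Signed as ℤ∣
open import Data.Integer.Tactic.RingSolver using (solve; solve-∀)
open import Data.Nat as ℕ using (ℕ; suc; _∸_; s≤s; z≤n)
import Data.Nat.Properties as ℕₚ
open import Data.Nat.DivMod using (_/_; m*n/n≡m)
open import Data.Nat.Divisibility using (_∣_; ∣-antisym; ∣1⇒≡1; n∣m*n; m∣m*n)
open import Data.Nat.Coprimality using (Coprime; coprime-divisor)
import Data.Nat.Tactic.RingSolver as ℕ-Solver
open import Data.List using ([]; _∷_)
open import Data.Product using (_×_; _,_; ∃; proj₁; proj₂)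
open import Data.Sum using ([_,_]′)
open import Function using (id; _∘_)
open import Relation.Binary.PropositionalEquality
open ≡-Reasoning

mat-cong : ∀ {a b c d a′ b′ c′ d′} → a ≡ a′ → b ≡ b′ → c ≡ c′ → d ≡ d′ →
           mat a b c d ≡ mat a′ b′ c′ d′
mat-cong refl refl refl refl = refl

ℤ² : Set
ℤ² = ℤ × ℤ

ω : ℤ² → ℤ² → ℤ
ω (p , q) (u , v) = p * v - q * u

_·_ : Mat → ℤ² → ℤ²
mat a b c d · (u , v) = (a * u + b * v , c * u + d * v)

mutate : ℤ → ℤ² → ℤ² → ℤ²
mutate t (p , q) (u , v) = (t * p - u , t * q - v)

ω-self : ∀ w → ω w w ≡ 0ℤ
ω-self (p , q) = begin
  p * q - q * p ≡⟨ solve (p ∷ q ∷ []) ⟩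
  0ℤ            ∎

ω-· : ∀ M u v → ω (M · u) (M · v) ≡ det M * ω u v
ω-· (mat a b c d) (p , q) (u , v) = begin
  (a * p + b * q) * (c * u + d * v) - (c * p + d * q) * (a * u + b * v)
    ≡⟨ solve (a ∷ b ∷ c ∷ d ∷ p ∷ q ∷ u ∷ v ∷ []) ⟩
  (a * d - b * c) * (p * v - q * u) ∎

ω-mutateˡ : ∀ a t w u → ω (mutate t w u) a ≡ t * ω w a - ω u a
ω-mutateˡ (s , s′) t (p , q) (u , v) = begin
  (t * p - u) * s′ - (t * q - v) * s      ≡⟨ solve (s ∷ s′ ∷ t ∷ p ∷ q ∷ u ∷ v ∷ []) ⟩
  t * (p * s′ - q * s) - (u * s′ - v * s) ∎

ω-mutateʳ : ∀ a t w u → ω a (mutate t w u) ≡ t * ω a w - ω a u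
ω-mutateʳ (s , s′) t (p , q) (u , v) = begin
  s * (t * q - v) - s′ * (t * p - u)      ≡⟨ solve (s ∷ s′ ∷ t ∷ p ∷ q ∷ u ∷ v ∷ []) ⟩
  t * (s * q - s′ * p) - (s * v - s′ * u) ∎

ω-mutate-selfˡ : ∀ t w u → ω (mutate t w u) w ≡ ω w u
ω-mutate-selfˡ t (p , q) (u , v) = begin
  (t * p - u) * q - (t * q - v) * p ≡⟨ solve (t ∷ p ∷ q ∷ u ∷ v ∷ []) ⟩
  p * v - q * u                     ∎

ω-mutate-selfʳ : ∀ t w u → ω w (mutate t w u) ≡ ω u w
ω-mutate-selfʳ t (p , q) (u , v) = begin
  p * (t * q - v) - q * (t * p - u) ≡⟨ solve (t ∷ p ∷ q ∷ u ∷ v ∷ []) ⟩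
  u * q - v * p                     ∎

Primitive : ℤ² → Set
Primitive w = ∃ λ w′ → ω w w′ ≡ + 1

primitive-· : ∀ M {w} → det M ≡ + 1 → Primitive w → Primitive (M · w)
primitive-· M {w} det≡1 (w′ , ω≡1) = M · w′ , (begin
  ω (M · w) (M · w′) ≡⟨ ω-· M w w′ ⟩
  det M * ω w w′     ≡⟨ cong₂ _*_ det≡1 ω≡1 ⟩
  + 1                ∎)

primitive-head1 : ∀ q → Primitive (+ 1 , q)
primitive-head1 q = (+ 0 , + 1) , (begin
  + 1 * + 1 - q * + 0 ≡⟨ solve (q ∷ []) ⟩
  + 1                 ∎)

primitive⇒coprime : ∀ {p q} → Primitive (p , q) → Coprime ∣ p ∣ ∣ q ∣
primitive⇒coprime {p} {q} ((s , t) , pt-qs≡1) {i} (i∣p , i∣q) =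
  ∣1⇒≡1 (ℤ∣.∣⇒∣ᵤ (subst (+ i ℤ∣.∣_) pt-qs≡1 (ℤ∣.∣m∣n⇒∣m-n
    (ℤ∣.∣m⇒∣m*n t (ℤ∣.∣ᵤ⇒∣ {+ i} {p} i∣p))
    (ℤ∣.∣m⇒∣m*n s (ℤ∣.∣ᵤ⇒∣ {+ i} {q} i∣q)))))

coprime-cross⇒∣≡∣ : ∀ {p q u v} → Coprime ∣ p ∣ ∣ q ∣ → Coprime ∣ u ∣ ∣ v ∣ →
                    p * v ≡ q * u → ∣ u ∣ ≡ ∣ p ∣
coprime-cross⇒∣≡∣ {p} {q} {u} {v} p⊥q u⊥v pv≡qu = ∣-antisym u∣p p∣u
  where
  ∣p∣∣v∣≡∣q∣∣u∣ : ∣ p ∣ ℕ.* ∣ v ∣ ≡ ∣ q ∣ ℕ.* ∣ u ∣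
  ∣p∣∣v∣≡∣q∣∣u∣ = trans (sym (ℤₚ.abs-* p v)) (trans (cong ∣_∣ pv≡qu) (ℤₚ.abs-* q u))
  u∣p : ∣ u ∣ ∣ ∣ p ∣
  u∣p = coprime-divisor u⊥v
    (subst (∣ u ∣ ∣_) (trans (sym ∣p∣∣v∣≡∣q∣∣u∣) (ℕₚ.*-comm ∣ p ∣ ∣ v ∣)) (n∣m*n ∣ q ∣))
  p∣u : ∣ p ∣ ∣ ∣ u ∣
  p∣u = coprime-divisor p⊥q (subst (∣ p ∣ ∣_) ∣p∣∣v∣≡∣q∣∣u∣ (m∣m*n ∣ v ∣))

-- −k·I + w (Jw)ᵀ for w = (p , q) and J the rotation by a right angle.
parabolic′ : ℤ → ℤ² → Mat
parabolic′ k (p , q) = mat (- k - p * q) (p * p) (- (q * q)) (- k + p * q)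

parabolic : ℤ² → Mat
parabolic = parabolic′ (+ 1)

det-parabolic : ∀ w → det (parabolic w) ≡ + 1
det-parabolic (p , q) = begin
  (- + 1 - p * q) * (- + 1 + p * q) - p * p * - (q * q) ≡⟨ solve (p ∷ q ∷ []) ⟩
  + 1                                                   ∎

det-inv : ∀ M → det (inv M) ≡ det M
det-inv (mat a b c d) = begin
  d * a - - b * - c ≡⟨ solve (a ∷ b ∷ c ∷ d ∷ []) ⟩
  a * d - b * c     ∎

inv-involutive : ∀ M → inv (inv M) ≡ M
inv-involutive (mat a b c d) = mat-cong refl (ℤₚ.neg-involutive b) (ℤₚ.neg-involutive c) refl

parabolic-· : ∀ w u → parabolic w · u ≡ mutate (ω w u) w u
parabolic-· (p , q) (u , v) = cong₂ _,_
  (begin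
    (- + 1 - p * q) * u + p * p * v ≡⟨ solve (p ∷ q ∷ u ∷ v ∷ []) ⟩
    (p * v - q * u) * p - u         ∎)
  (begin
    - (q * q) * u + (- + 1 + p * q) * v ≡⟨ solve (p ∷ q ∷ u ∷ v ∷ []) ⟩
    (p * v - q * u) * q - v             ∎)

inv-parabolic-· : ∀ w u → inv (parabolic w) · u ≡ mutate (ω u w) w u
inv-parabolic-· (p , q) (u , v) = cong₂ _,_
  (begin
    (- + 1 + p * q) * u + - (p * p) * v ≡⟨ solve (p ∷ q ∷ u ∷ v ∷ []) ⟩
    (u * q - v * p) * p - u             ∎)
  (begin
    - - (q * q) * u + (- + 1 - p * q) * v ≡⟨ solve (p ∷ q ∷ u ∷ v ∷ []) ⟩
    (u * q - v * p) * q - v               ∎)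

conj-parabolic′ : ∀ M k w → (M ⊗ parabolic′ k w) ⊗ inv M ≡ parabolic′ (k * det M) (M · w)
conj-parabolic′ (mat a b c d) k (p , q) = mat-cong e₁ e₂ e₃ e₄
  where
  e₁ : (a * (- k - p * q) + b * - (q * q)) * d + (a * (p * p) + b * (- k + p * q)) * - c
     ≡ - (k * (a * d - b * c)) - (a * p + b * q) * (c * p + d * q)
  e₁ = solve (a ∷ b ∷ c ∷ d ∷ k ∷ p ∷ q ∷ [])
  e₂ : (a * (- k - p * q) + b * - (q * q)) * - b + (a * (p * p) + b * (- k + p * q)) * a
     ≡ (a * p + b * q) * (a * p + b * q)
  e₂ = solve (a ∷ b ∷ c ∷ d ∷ k ∷ p ∷ q ∷ [])
  e₃ : (c * (- k - p * q) + d * - (q * q)) * d + (c * (p * p) + d * (- k + p * q)) * - c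
     ≡ - ((c * p + d * q) * (c * p + d * q))
  e₃ = solve (a ∷ b ∷ c ∷ d ∷ k ∷ p ∷ q ∷ [])
  e₄ : (c * (- k - p * q) + d * - (q * q)) * - b + (c * (p * p) + d * (- k + p * q)) * a
     ≡ - (k * (a * d - b * c)) + (a * p + b * q) * (c * p + d * q)
  e₄ = solve (a ∷ b ∷ c ∷ d ∷ k ∷ p ∷ q ∷ [])

conj-parabolic : ∀ M w → det M ≡ + 1 → (M ⊗ parabolic w) ⊗ inv M ≡ parabolic (M · w)
conj-parabolic M w det≡1 =
  trans (conj-parabolic′ M (+ 1) w) (cong (λ k → parabolic′ (+ 1 * k) (M · w)) det≡1)

parabolic-conj : ∀ w u →
  (parabolic w ⊗ parabolic u) ⊗ inv (parabolic w) ≡ parabolic (mutate (ω w u) w u)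
parabolic-conj w u =
  trans (conj-parabolic (parabolic w) u (det-parabolic w)) (cong parabolic (parabolic-· w u))

parabolic-conj⁻¹ : ∀ w u →
  (inv (parabolic w) ⊗ parabolic u) ⊗ parabolic w ≡ parabolic (mutate (ω u w) w u)
parabolic-conj⁻¹ w u = begin
  (inv (parabolic w) ⊗ parabolic u) ⊗ parabolic w
    ≡⟨ cong ((inv (parabolic w) ⊗ parabolic u) ⊗_) (inv-involutive (parabolic w)) ⟨
  (inv (parabolic w) ⊗ parabolic u) ⊗ inv (inv (parabolic w))
    ≡⟨ conj-parabolic (inv (parabolic w)) u (trans (det-inv (parabolic w)) (det-parabolic w)) ⟩
  parabolic (inv (parabolic w) · u)
    ≡⟨ cong parabolic (inv-parabolic-· w u) ⟩
  parabolic (mutate (ω u w) w u) ∎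

primitive-mutate : ∀ w u → Primitive u → Primitive (mutate (ω w u) w u)
primitive-mutate w u =
  subst Primitive (parabolic-· w u) ∘ primitive-· (parabolic w) (det-parabolic w)

primitive-mutate⁻¹ : ∀ w u → Primitive u → Primitive (mutate (ω u w) w u)
primitive-mutate⁻¹ w u =
  subst Primitive (inv-parabolic-· w u) ∘
  primitive-· (inv (parabolic w)) (trans (det-inv (parabolic w)) (det-parabolic w))

ω²≡fixedBy-defect : ∀ p q u v → (p * v - q * u) * (p * v - q * u)
  ≡ v * ((- + 1 - p * q) * u + p * p * v) - u * (- (q * q) * u + (- + 1 + p * q) * v)
ω²≡fixedBy-defect = solve-∀

fixedBy-parabolic⇒ω≡0 : ∀ w {u v} → FixedBy (parabolic w) u v → ω w (u , v) ≡ 0ℤ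
fixedBy-parabolic⇒ω≡0 (p , q) {u} {v} fixed = [ id , id ]′ (ℤₚ.i*j≡0⇒i≡0∨j≡0 _
  (trans (ω²≡fixedBy-defect p q u v) (ℤₚ.i≡j⇒i-j≡0 fixed)))

ω≡0⇒fixedBy-parabolic : ∀ w {u v} → ω w (u , v) ≡ 0ℤ → FixedBy (parabolic w) u v
ω≡0⇒fixedBy-parabolic (p , q) {u} {v} ω≡0 = ℤₚ.i-j≡0⇒i≡j _ _
  (trans (sym (ω²≡fixedBy-defect p q u v)) (cong (λ t → t * t) ω≡0))

fixNum-parabolic : ∀ {w n} → Primitive w → proj₁ w ≡ + n → FixNum (parabolic w) n
fixNum-parabolic {p , q} {n} prim p≡n =
  (p , q , p⊥q , ω≡0⇒fixedBy-parabolic (p , q) (ω-self (p , q))) , numerator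
  where
  p⊥q : Coprime ∣ p ∣ ∣ q ∣
  p⊥q = primitive⇒coprime {p} {q} prim
  numerator : ∀ u v → PrimFixed (parabolic (p , q)) u v → ∣ u ∣ ≡ n
  numerator u v (u⊥v , fixed) = begin
    ∣ u ∣ ≡⟨ coprime-cross⇒∣≡∣ {p} {q} p⊥q u⊥v
               (ℤₚ.i-j≡0⇒i≡j _ _ (fixedBy-parabolic⇒ω≡0 (p , q) {u} {v} fixed)) ⟩
    ∣ p ∣ ≡⟨ cong ∣_∣ p≡n ⟩
    n     ∎

record MarkovFrame (a b c : ℤ²) (x y z : ℤ) : Set where
  field
    head-a : proj₁ a ≡ x
    head-b : proj₁ b ≡ y
    head-c : proj₁ c ≡ z
    ω-ab   : ω a b ≡ + 3 * z
    ω-bc   : ω b c ≡ + 3 * x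
    ω-ac   : ω a c ≡ + 3 * (+ 3 * x * z - y)

markovFrame-mutateL : ∀ {a b c x y z} → MarkovFrame a b c x y z →
                      MarkovFrame a (mutate (ω b c) b c) b x (+ 3 * x * y - z) y
markovFrame-mutateL {a} {b} {c} {x} {y} {z} F = record
  { head-a = head-a
  ; head-b = cong₂ _-_ (cong₂ _*_ ω-bc head-b) head-c
  ; head-c = head-b
  ; ω-ab   = begin
      ω a (mutate (ω b c) b c)                      ≡⟨ ω-mutateʳ a (ω b c) b c ⟩
      ω b c * ω a b - ω a c                         ≡⟨ cong₂ _-_ (cong₂ _*_ ω-bc ω-ab) ω-ac ⟩
      + 3 * x * (+ 3 * z) - + 3 * (+ 3 * x * z - y) ≡⟨ solve (x ∷ y ∷ z ∷ []) ⟩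
      + 3 * y                                       ∎
  ; ω-bc   = trans (ω-mutate-selfˡ (ω b c) b c) ω-bc
  ; ω-ac   = begin
      ω a b                                  ≡⟨ ω-ab ⟩
      + 3 * z                                ≡⟨ solve (x ∷ y ∷ z ∷ []) ⟩
      + 3 * (+ 3 * x * y - (+ 3 * x * y - z)) ∎
  }
  where open MarkovFrame F

markovFrame-mutateR : ∀ {a b c x y z} → MarkovFrame a b c x y z →
                      MarkovFrame b (mutate (ω a b) b a) c y (+ 3 * y * z - x) z
markovFrame-mutateR {a} {b} {c} {x} {y} {z} F = record
  { head-a = head-b
  ; head-b = begin
      ω a b * proj₁ b - proj₁ a ≡⟨ cong₂ _-_ (cong₂ _*_ ω-ab head-b) head-a ⟩
      + 3 * z * y - x           ≡⟨ solve (x ∷ y ∷ z ∷ []) ⟩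
      + 3 * y * z - x           ∎
  ; head-c = head-c
  ; ω-ab   = trans (ω-mutate-selfʳ (ω a b) b a) ω-ab
  ; ω-bc   = begin
      ω (mutate (ω a b) b a) c                      ≡⟨ ω-mutateˡ c (ω a b) b a ⟩
      ω a b * ω b c - ω a c                         ≡⟨ cong₂ _-_ (cong₂ _*_ ω-ab ω-bc) ω-ac ⟩
      + 3 * z * (+ 3 * x) - + 3 * (+ 3 * x * z - y) ≡⟨ solve (x ∷ y ∷ z ∷ []) ⟩
      + 3 * y                                       ∎
  ; ω-ac   = begin
      ω b c                                   ≡⟨ ω-bc ⟩
      + 3 * x                                 ≡⟨ solve (x ∷ y ∷ z ∷ []) ⟩
      + 3 * (+ 3 * y * z - (+ 3 * y * z - x)) ∎
  }
  where open MarkovFrame F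

vieta : ∀ {s t z} → 1 ℕ.≤ z → s ℕ.+ z ℕ.* z ≡ t ℕ.* z →
        s ÷ z ℕ.+ z ≡ t × s ÷ z ℕ.* z ≡ s
vieta {s} {t} {z@(suc _)} _ eq =
  subst (λ k → k ℕ.+ z ≡ t × k ℕ.* z ≡ s) (sym s÷z≡k) (k+z≡t , k*z≡s)
  where
  z≤t : z ℕ.≤ t
  z≤t = ℕₚ.*-cancelʳ-≤ z t z (ℕₚ.≤-trans (ℕₚ.m≤n+m (z ℕ.* z) s) (ℕₚ.≤-reflexive eq))
  k : ℕ
  k = t ∸ z
  k+z≡t : k ℕ.+ z ≡ t
  k+z≡t = ℕₚ.m∸n+n≡m z≤t
  k*z≡s : k ℕ.* z ≡ s
  k*z≡s = ℕₚ.+-cancelʳ-≡ (z ℕ.* z) _ _ (begin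
    k ℕ.* z ℕ.+ z ℕ.* z ≡⟨ ℕₚ.*-distribʳ-+ z k z ⟨
    (k ℕ.+ z) ℕ.* z     ≡⟨ cong (ℕ._* z) k+z≡t ⟩
    t ℕ.* z             ≡⟨ eq ⟨
    s ℕ.+ z ℕ.* z       ∎)
  s÷z≡k : s ÷ z ≡ k
  s÷z≡k = trans (cong (_/ z) (sym k*z≡s)) (m*n/n≡m k z)

markov-partner-identity : ∀ {x y z k} →
                          k ℕ.+ z ≡ 3 ℕ.* x ℕ.* y → k ℕ.* z ≡ x ℕ.* x ℕ.+ y ℕ.* y →
                          x ℕ.* x ℕ.+ k ℕ.* k ℕ.+ y ℕ.* y ≡ 3 ℕ.* x ℕ.* k ℕ.* y
markov-partner-identity {x} {y} {z} {k} k+z≡3xy k*z≡x²+y² = begin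
  x ℕ.* x ℕ.+ k ℕ.* k ℕ.+ y ℕ.* y   ≡⟨ ℕ-Solver.solve (x ∷ y ∷ k ∷ []) ⟩
  (x ℕ.* x ℕ.+ y ℕ.* y) ℕ.+ k ℕ.* k ≡⟨ cong (ℕ._+ k ℕ.* k) k*z≡x²+y² ⟨
  k ℕ.* z ℕ.+ k ℕ.* k               ≡⟨ ℕ-Solver.solve (z ∷ k ∷ []) ⟩
  (k ℕ.+ z) ℕ.* k                   ≡⟨ cong (ℕ._* k) k+z≡3xy ⟩
  3 ℕ.* x ℕ.* y ℕ.* k               ≡⟨ ℕ-Solver.solve (x ∷ y ∷ k ∷ []) ⟩
  3 ℕ.* x ℕ.* k ℕ.* y               ∎

markov-partner : ∀ {x y z k} → 1 ℕ.≤ x → 1 ℕ.≤ y →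
                 k ℕ.+ z ≡ 3 ℕ.* x ℕ.* y → k ℕ.* z ≡ x ℕ.* x ℕ.+ y ℕ.* y → IsMarkov (x , k , y)
markov-partner {k = 0}             (s≤s z≤n) _   _       ()
markov-partner {x} {y} {z} {suc k} x≥1       y≥1 k+z≡3xy k*z≡x²+y² =
  x≥1 , s≤s z≤n , y≥1 , markov-partner-identity {x} {y} {z} k+z≡3xy k*z≡x²+y²

markov-mutation : ∀ {x y z} → IsMarkov (x , y , z) →
                  let k = (x ℕ.* x ℕ.+ y ℕ.* y) ÷ z in
                  k ℕ.+ z ≡ 3 ℕ.* x ℕ.* y × IsMarkov (x , k , y)
markov-mutation (x≥1 , y≥1 , z≥1 , eq) =
  proj₁ partner , markov-partner x≥1 y≥1 (proj₁ partner) (proj₂ partner)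
  where partner = vieta z≥1 eq

markov-rotate : ∀ {x y z} → IsMarkov (x , y , z) → IsMarkov (y , z , x)
markov-rotate {x} {y} {z} (x≥1 , y≥1 , z≥1 , eq) = y≥1 , z≥1 , x≥1 , (begin
  y ℕ.* y ℕ.+ z ℕ.* z ℕ.+ x ℕ.* x ≡⟨ ℕ-Solver.solve (x ∷ y ∷ z ∷ []) ⟩
  x ℕ.* x ℕ.+ y ℕ.* y ℕ.+ z ℕ.* z ≡⟨ eq ⟩
  3 ℕ.* x ℕ.* y ℕ.* z             ≡⟨ ℕ-Solver.solve (x ∷ y ∷ z ∷ []) ⟩
  3 ℕ.* y ℕ.* z ℕ.* x             ∎)

+≡⇒≡- : ∀ {i j t} → i + j ≡ t → i ≡ t - j
+≡⇒≡- {i} {j} refl = begin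
  i         ≡⟨ solve (i ∷ j ∷ []) ⟩
  i + j - j ∎

pos-mutant : ∀ {k x y z} → k ℕ.+ z ≡ 3 ℕ.* x ℕ.* y → + k ≡ + 3 * + x * + y - + z
pos-mutant {k} {x} {y} {z} k+z≡3xy = +≡⇒≡- (begin
  + k + + z               ≡⟨ ℤₚ.pos-+ k z ⟨
  + (k ℕ.+ z)             ≡⟨ cong +_ k+z≡3xy ⟩
  + (3 ℕ.* x ℕ.* y)       ≡⟨ ℤₚ.pos-* (3 ℕ.* x) y ⟩
  + (3 ℕ.* x) * + y       ≡⟨ cong (_* + y) (ℤₚ.pos-* 3 x) ⟩
  + 3 * + x * + y         ∎)

VTriple : Set
VTriple = ℤ² × ℤ² × ℤ²

stepMMᵛ : Dir → VTriple → VTriple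
stepMMᵛ L (a , b , c) = (a , mutate (ω b c) b c , b)
stepMMᵛ R (a , b , c) = (b , mutate (ω a b) b a , c)

MMTᵛ : ℤ → Path → VTriple
MMTᵛ l []      = ((+ 1 , - + 1 - l) , (+ 2 , + 1 - + 2 * l) , (+ 1 , + 2 - l))
MMTᵛ l (d ∷ p) = stepMMᵛ d (MMTᵛ l p)

parabolic³ : VTriple → MTriple
parabolic³ (a , b , c) = (parabolic a , parabolic b , parabolic c)

stepMM-parabolic³ : ∀ d W → stepMM d (parabolic³ W) ≡ parabolic³ (stepMMᵛ d W)
stepMM-parabolic³ L (a , b , c) = cong (λ M → parabolic a , M , parabolic b) (parabolic-conj b c)
stepMM-parabolic³ R (a , b , c) = cong (λ M → parabolic b , M , parabolic c) (parabolic-conj⁻¹ b a)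

MMT≡parabolic³ : ∀ l p → MMT l p ≡ parabolic³ (MMTᵛ l p)
MMT≡parabolic³ l [] = cong₂ _,_ X≡ (cong₂ _,_ Y≡ Z≡)
  where
  X≡ : Xℓ l ≡ parabolic (+ 1 , - + 1 - l)
  X≡ = mat-cong (solve (l ∷ [])) refl (solve (l ∷ [])) (solve (l ∷ []))
  Y≡ : Yℓ l ≡ parabolic (+ 2 , + 1 - + 2 * l)
  Y≡ = mat-cong (solve (l ∷ [])) refl (solve (l ∷ [])) (solve (l ∷ []))
  Z≡ : Zℓ l ≡ parabolic (+ 1 , + 2 - l)
  Z≡ = mat-cong (solve (l ∷ [])) refl (solve (l ∷ [])) (solve (l ∷ []))
MMT≡parabolic³ l (d ∷ p) =
  trans (cong (stepMM d) (MMT≡parabolic³ l p)) (stepMM-parabolic³ d (MMTᵛ l p))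

Primitive³ : VTriple → Set
Primitive³ (a , b , c) = Primitive a × Primitive b × Primitive c

stepMMᵛ-primitive : ∀ d {W} → Primitive³ W → Primitive³ (stepMMᵛ d W)
stepMMᵛ-primitive L {a , b , c} (prim-a , prim-b , prim-c) =
  prim-a , primitive-mutate b c prim-c , prim-b
stepMMᵛ-primitive R {a , b , c} (prim-a , prim-b , prim-c) =
  prim-b , primitive-mutate⁻¹ b a prim-a , prim-c

MMTᵛ-primitive : ∀ l p → Primitive³ (MMTᵛ l p)
MMTᵛ-primitive l [] = primitive-head1 (- + 1 - l) , prim-b , primitive-head1 (+ 2 - l)
  where
  prim-b : Primitive (+ 2 , + 1 - + 2 * l)
  prim-b = (- + 1 , l) , (begin
    + 2 * l - (+ 1 - + 2 * l) * - + 1 ≡⟨ solve (l ∷ []) ⟩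
    + 1                               ∎)
MMTᵛ-primitive l (d ∷ p) = stepMMᵛ-primitive d (MMTᵛ-primitive l p)

Labels : VTriple → NTriple → Set
Labels (a , b , c) (x , y , z) = MarkovFrame a b c (+ x) (+ y) (+ z) × IsMarkov (x , y , z)

stepMMᵛ-labels : ∀ d {W N} → Labels W N → Labels (stepMMᵛ d W) (stepM d N)
stepMMᵛ-labels L {a , b , c} {x , y , z} (F , markov)
  with k+z≡3xy , markov′ ← markov-mutation markov =
  subst (λ k → MarkovFrame a (mutate (ω b c) b c) b (+ x) k (+ y))
        (sym (pos-mutant {x = x} {y} {z} k+z≡3xy)) (markovFrame-mutateL F) ,
  markov′
stepMMᵛ-labels R {a , b , c} {x , y , z} (F , markov)
  with k+x≡3yz , markov′ ← markov-mutation (markov-rotate markov) =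
  subst (λ k → MarkovFrame b (mutate (ω a b) b a) c (+ y) k (+ z))
        (sym (pos-mutant {x = y} {z} {x} k+x≡3yz)) (markovFrame-mutateR F) ,
  markov′

MMTᵛ-labels : ∀ l p → Labels (MMTᵛ l p) (MT0 p)
MMTᵛ-labels l [] = root , (s≤s z≤n , s≤s z≤n , s≤s z≤n , refl)
  where
  root : MarkovFrame (+ 1 , - + 1 - l) (+ 2 , + 1 - + 2 * l) (+ 1 , + 2 - l) (+ 1) (+ 2) (+ 1)
  root = record
    { head-a = refl
    ; head-b = refl
    ; head-c = refl
    ; ω-ab   = begin
        + 1 * (+ 1 - + 2 * l) - (- + 1 - l) * + 2 ≡⟨ solve (l ∷ []) ⟩
        + 3 * + 1                                 ∎
    ; ω-bc   = begin
        + 2 * (+ 2 - l) - (+ 1 - + 2 * l) * + 1 ≡⟨ solve (l ∷ []) ⟩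
        + 3 * + 1                               ∎
    ; ω-ac   = begin
        + 1 * (+ 2 - l) - (- + 1 - l) * + 1 ≡⟨ solve (l ∷ []) ⟩
        + 3 * (+ 3 * + 1 * + 1 - + 2)       ∎
    }
MMTᵛ-labels l (d ∷ p) = stepMMᵛ-labels d (MMTᵛ-labels l p)

fixNums-parabolic³ : ∀ {W N} → Primitive³ W → Labels W N → FixNums (parabolic³ W) N
fixNums-parabolic³ {a , b , c} (prim-a , prim-b , prim-c) (F , _) =
  fixNum-parabolic prim-a head-a , fixNum-parabolic prim-b head-b , fixNum-parabolic prim-c head-c
  where open MarkovFrame F

corollary6p7 : (l : ℤ) (p : Path) →
    FixNums (MMT l p) (MT0 p) × IsMarkov (MT0 p)
corollary6p7 l p =
  subst (λ T → FixNums T (MT0 p)) (sym (MMT≡parabolic³ l p))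
        (fixNums-parabolic³ (MMTᵛ-primitive l p) (MMTᵛ-labels l p)) ,
  proj₂ (MMTᵛ-labels l p)
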